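{- Let $m\ge 2$ be even and let $n=a_0+a_1m+\cdots+a_km^k$ be the base-$m$ representation of $n$. Let $e_m(n)$ (resp. $o_m(n)$) be the number of partitions of $n$ into powers of $m$ with an even (resp. odd) number of parts. Then \[ e_m(n)-o_m(n)=(-1)^{a_0}\prod_{j=1}^{k}\frac{1+(-1)^{a_j}}{2}. \] In particular $|e_m(n)-o_m(n)|\le 1$.
   Context: A partition of $n$ into powers of $m$ is a representation $n=m^{i_1}+\cdots+m^{i_r}$ with $0\le i_1\le\cdots\le i_r$; $r$ is its number of parts. An empty product equals $1$. -}

module Defs where

open import Data.Nat using (ℕ; zero; suc; _+_; _*_; _^_; _≤_; _%_)
open import Data.List using (List; []; _∷_; length; map; foldr)
open import Data.Nat.ListAction using (sum)
open import Data.List.Relation.Unary.Linked using (Linked)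
open import Data.Product using (Σ; _×_)
open import Relation.Binary.PropositionalEquality using (_≡_)
open import Data.Integer as ℤ using (ℤ; -1ℤ; 1ℤ)
open import Data.Rational as ℚ using (ℚ; 1ℚ)

-- A partition of n into powers of m, recorded by its exponent list
-- i₁ ≤ i₂ ≤ … ≤ i_r with n = m^{i₁} + … + m^{i_r}; r = length of the list.
IsPowerPartition : ℕ → ℕ → List ℕ → Set
IsPowerPartition m n is = Linked _≤_ is × sum (map (m ^_) is) ≡ n

EvenPartitions : ℕ → ℕ → Set
EvenPartitions m n = Σ (List ℕ) λ is → IsPowerPartition m n is × length is % 2 ≡ 0

OddPartitions : ℕ → ℕ → Set
OddPartitions m n = Σ (List ℕ) λ is → IsPowerPartition m n is × length is % 2 ≡ 1

baseValue : ℕ → List ℕ → ℕ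
baseValue m []       = 0
baseValue m (a ∷ as) = a + m * baseValue m as

halfFactor : ℕ → ℚ
halfFactor a = (1ℤ ℤ.+ (-1ℤ ℤ.^ a)) ℚ./ 2

prodHalfFactors : List ℕ → ℚ
prodHalfFactors = foldr (λ a r → halfFactor a ℚ.* r) 1ℚ

{-# OPTIONS --safe #-}
module Submission where

-- A partition of n + 1 into powers of m either has a part 1, whose removal leaves a partition
-- of n with the other parity of the number of parts, or has all parts divisible by m, and then
-- is m times a partition of (n + 1) / m. This decomposition enumerates the partitions by strong
-- induction, and shows that f = e_m − o_m satisfies f 0 = 1 and
-- f (n + 1) = − f n + [m ∣ n + 1] f ((n + 1) / m). For m even and S k = f 0 + ⋯ + f k, induction
-- on k gives f (a + m k) = (−1)^a S k and S (a + m k) = [a even] S k for every digit a < m;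
-- unrolling along the base-m digits of n yields the formula.

open import Defs
open import Data.Nat as ℕ
  using (ℕ; zero; suc; pred; _≤_; _<_; z≤n; s≤s; _%_; _∸_; _^_; _+_; _*_;
         NonZero; NonTrivial; nonTrivial⇒nonZero)
open import Data.Nat.Properties
  using (≤-refl; ≤-trans; ≤-reflexive; ≤-irrelevant; ≡-irrelevant; <⇒≢; <⇒≱; m≤n⇒m≤1+n; pred-mono-≤;
         suc-injective; 0≢1+n; m+n≡0⇒m≡0; m∸n≤m; m∸[m∸n]≡n; m^n>0;
         +-comm; *-comm; *-suc; *-zeroʳ; *-distribˡ-+; *-cancelˡ-≡)
open import Data.Nat.DivMod using (m*n%n≡0)
open import Data.Nat.Divisibility
  using (_∣_; _∣?_; divides; quotient-<; m∣n⇒n≡m*quotient; ∣m+n∣m⇒∣n; m∣m*n; ∣⇒≤)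
open import Data.Nat.ListAction using (sum)
open import Data.Nat.Induction using (<-rec)
open import Data.List using (List; []; _∷_; map; length; foldr; last)
open import Data.List.Properties using (length-map; map-∘; map-id)
open import Data.List.Relation.Unary.All using (All; []; _∷_)
open import Data.List.Relation.Unary.Linked as Linked using (Linked; []; [-]; _∷_)
open import Data.List.Relation.Unary.Linked.Properties using (Linked⇒All; map⁺)
open import Data.Maybe using (just)
open import Data.Sum using (_⊎_; inj₁; inj₂)
open import Data.Sum.Function.Propositional using (_⊎-↔_)
open import Data.Product using (Σ; _×_; _,_; proj₁; proj₂)
open import Data.Empty using (⊥-elim)
open import Data.Fin using (Fin; zero)
open import Data.Fin.Properties using (+↔⊎; cantor-schröder-bernstein)
open import Function.Bundles using (_↔_; mk↔ₛ′; Injection)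
open import Function.Properties.Inverse using (↔-trans; ↔-sym; ↔⇒↣)
open import Relation.Nullary using (¬_; yes; no)
open import Relation.Binary.PropositionalEquality
  using (_≡_; _≢_; refl; sym; trans; cong; cong₂; subst; module ≡-Reasoning)
open import Data.Integer as ℤ using (ℤ; +_; -_; -1ℤ; 0ℤ; 1ℤ; ∣_∣)
import Data.Integer.Properties as ℤP
open import Data.Integer.Tactic.RingSolver using (solve-∀)
open import Data.Rational as ℚ using (ℚ)
import Data.Rational.Properties as ℚP

private
  variable
    A B : Set
    a b c d k n : ℕ

Finite : Set → Set
Finite A = Σ ℕ λ c → Fin c ↔ A

card-unique : Fin a ↔ A → Fin b ↔ A → a ≡ b
card-unique i j = cantor-schröder-bernstein
  (Injection.injective (↔⇒↣ (↔-trans i (↔-sym j))))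
  (Injection.injective (↔⇒↣ (↔-trans j (↔-sym i))))

Finite-↔ : A ↔ B → Finite A → Finite B
Finite-↔ A↔B (c , i) = c , ↔-trans i A↔B

Finite-⊎ : Finite A → Finite B → Finite (A ⊎ B)
Finite-⊎ (a , i) (b , j) = a + b , ↔-trans +↔⊎ (i ⊎-↔ j)

card-⊎ : Fin a ↔ A → Fin b ↔ B → Fin c ↔ (A ⊎ B) → c ≡ a + b
card-⊎ i j k = card-unique k (proj₂ (Finite-⊎ (_ , i) (_ , j)))

Finite-empty : ¬ A → Finite A
Finite-empty ¬a = 0 , mk↔ₛ′ (λ ()) (λ x → ⊥-elim (¬a x)) (λ x → ⊥-elim (¬a x)) (λ ())

Finite-singleton : (x : A) → (∀ y → x ≡ y) → Finite A
Finite-singleton x unique = 1 , mk↔ₛ′ (λ _ → x) (λ _ → zero) unique (λ { zero → refl })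

[1+l]%2≡1∸l%2 : ∀ l → suc l % 2 ≡ 1 ∸ l % 2
[1+l]%2≡1∸l%2 zero          = refl
[1+l]%2≡1∸l%2 (suc zero)    = refl
[1+l]%2≡1∸l%2 (suc (suc l)) = [1+l]%2≡1∸l%2 l

l%2≡1∸[1+l]%2 : ∀ l → l % 2 ≡ 1 ∸ suc l % 2
l%2≡1∸[1+l]%2 zero          = refl
l%2≡1∸[1+l]%2 (suc zero)    = refl
l%2≡1∸[1+l]%2 (suc (suc l)) = l%2≡1∸[1+l]%2 l

parity-suc⁻ : ∀ l → suc l % 2 ≡ b → l % 2 ≡ 1 ∸ b
parity-suc⁻ l e = trans (l%2≡1∸[1+l]%2 l) (cong (1 ∸_) e)

parity-suc⁺ : ∀ l → b ≤ 1 → l % 2 ≡ 1 ∸ b → suc l % 2 ≡ b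
parity-suc⁺ l b≤1 e = trans ([1+l]%2≡1∸l%2 l) (trans (cong (1 ∸_) e) (m∸[m∸n]≡n b≤1))

[1+m]≡2*t⇒m%2≡1 : ∀ {m} t → suc m ≡ 2 * t → m % 2 ≡ 1
[1+m]≡2*t⇒m%2≡1 {m} t eq =
  trans (l%2≡1∸[1+l]%2 m) (cong (1 ∸_) (trans (cong (_% 2) (trans eq (*-comm 2 t))) (m*n%n≡0 t 2)))

powerSum : ℕ → List ℕ → ℕ
powerSum m is = sum (map (m ^_) is)

powerSum-map-suc : ∀ m is → powerSum m (map suc is) ≡ m * powerSum m is
powerSum-map-suc m []       = sym (*-zeroʳ m)
powerSum-map-suc m (i ∷ is) =
  trans (cong (λ s → m * m ^ i + s) (powerSum-map-suc m is)) (sym (*-distribˡ-+ m (m ^ i) _))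

powerSum≡0⇒[] : ∀ m .{{_ : NonZero m}} is → powerSum m is ≡ 0 → is ≡ []
powerSum≡0⇒[] m []       _  = refl
powerSum≡0⇒[] m (i ∷ is) eq = ⊥-elim (<⇒≢ (m^n>0 m i) (sym (m+n≡0⇒m≡0 (m ^ i) eq)))

0∷-sorted : ∀ {is} → Linked _≤_ is → Linked _≤_ (0 ∷ is)
0∷-sorted {[]}    _      = [-]
0∷-sorted {_ ∷ _} sorted = z≤n ∷ sorted

map-suc-pred : ∀ {is} → All (1 ≤_) is → map suc (map pred is) ≡ is
map-suc-pred []             = refl
map-suc-pred (s≤s _ ∷ pos) = cong (_ ∷_) (map-suc-pred pos)

map-pred-suc : ∀ is → map pred (map suc is) ≡ is
map-pred-suc is = trans (sym (map-∘ is)) (map-id is)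

ExponentLists : (List ℕ → ℕ) → ℕ → ℕ → Set
ExponentLists w n b = Σ (List ℕ) λ is → (Linked _≤_ is × w is ≡ n) × length is % 2 ≡ b

ExponentLists-≡ : ∀ {w} {p q : ExponentLists w n b} → proj₁ p ≡ proj₁ q → p ≡ q
ExponentLists-≡ {p = is , (s , e) , r} {q = .is , (s′ , e′) , r′} refl =
  cong (is ,_) (cong₂ _,_ (cong₂ _,_ (Linked.irrelevant ≤-irrelevant s s′) (≡-irrelevant e e′))
                          (≡-irrelevant r r′))

Partitions : ℕ → ℕ → ℕ → Set
Partitions m = ExponentLists (powerSum m)

-- Partitions of n into powers of m with no part 1, recorded by their exponents lowered by one.
PartitionsWithoutOnes : ℕ → ℕ → ℕ → Set
PartitionsWithoutOnes m = ExponentLists (λ is → m * powerSum m is)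

module Counting (m : ℕ) .{{_ : NonTrivial m}} where

  private instance
    m-nonZero : NonZero m
    m-nonZero = nonTrivial⇒nonZero m

  partitions-suc-↔ : b ≤ 1 →
    Partitions m (suc n) b ↔ (Partitions m n (1 ∸ b) ⊎ PartitionsWithoutOnes m (suc n) b)
  partitions-suc-↔ {b} {n} b≤1 = mk↔ₛ′ split join split∘join join∘split
    where
    split : Partitions m (suc n) b → Partitions m n (1 ∸ b) ⊎ PartitionsWithoutOnes m (suc n) b
    split ([] , (_ , ()) , _)
    split (zero ∷ is , (sorted , sum≡) , parity) =
      inj₁ (is , (Linked.tail sorted , suc-injective sum≡) , parity-suc⁻ (length is) parity)
    split (is@(suc _ ∷ _) , (sorted , sum≡) , parity) =
      inj₂ (map pred is , (map⁺ (Linked.map pred-mono-≤ sorted) , lowered-sum) ,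
            trans (cong (_% 2) (length-map pred is)) parity)
      where
      lowered-sum : m * powerSum m (map pred is) ≡ suc n
      lowered-sum = trans (sym (powerSum-map-suc m (map pred is)))
        (trans (cong (powerSum m) (map-suc-pred (Linked⇒All ≤-trans (s≤s z≤n) sorted))) sum≡)

    join : Partitions m n (1 ∸ b) ⊎ PartitionsWithoutOnes m (suc n) b → Partitions m (suc n) b
    join (inj₁ (is , (sorted , sum≡) , parity)) =
      0 ∷ is , (0∷-sorted sorted , cong suc sum≡) , parity-suc⁺ (length is) b≤1 parity
    join (inj₂ (js , (sorted , sum≡) , parity)) =
      map suc js , (map⁺ (Linked.map s≤s sorted) , trans (powerSum-map-suc m js) sum≡) ,
      trans (cong (_% 2) (length-map suc js)) parity

    split∘join : ∀ y → split (join y) ≡ y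
    split∘join (inj₁ _)                      = cong inj₁ (ExponentLists-≡ refl)
    split∘join (inj₂ ([] , (_ , sum≡) , _))  = ⊥-elim (0≢1+n (trans (sym (*-zeroʳ m)) sum≡))
    split∘join (inj₂ (js@(_ ∷ _) , _))       = cong inj₂ (ExponentLists-≡ (map-pred-suc js))

    join∘split : ∀ x → join (split x) ≡ x
    join∘split ([] , (_ , ()) , _)
    join∘split (zero ∷ _ , _)                     = ExponentLists-≡ refl
    join∘split (suc _ ∷ _ , (sorted , _) , _)     =
      ExponentLists-≡ (map-suc-pred (Linked⇒All ≤-trans (s≤s z≤n) sorted))

  withoutOnes-↔ : n ≡ m * k → PartitionsWithoutOnes m n b ↔ Partitions m k b
  withoutOnes-↔ n≡mk = mk↔ₛ′
    (λ { (is , (sorted , sum≡) , parity) → is , (sorted , *-cancelˡ-≡ _ _ m (trans sum≡ n≡mk)) , parity })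
    (λ { (is , (sorted , sum≡) , parity) → is , (sorted , trans (cong (m *_) sum≡) (sym n≡mk)) , parity })
    (λ _ → ExponentLists-≡ refl) (λ _ → ExponentLists-≡ refl)

  withoutOnes-indivisible : ¬ m ∣ n → ¬ PartitionsWithoutOnes m n b
  withoutOnes-indivisible m∤n (is , (_ , sum≡) , _) =
    m∤n (divides (powerSum m is) (trans (sym sum≡) (*-comm m _)))

  even-partitions-of-0 : Fin 1 ↔ Partitions m 0 0
  even-partitions-of-0 = proj₂ (Finite-singleton ([] , ([] , refl) , refl)
    (λ { (is , (_ , sum≡0) , _) → ExponentLists-≡ (sym (powerSum≡0⇒[] m is sum≡0)) }))

  no-odd-partition-of-0 : ¬ Partitions m 0 1
  no-odd-partition-of-0 (is , (_ , sum≡0) , odd) =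
    0≢1+n (trans (cong (λ js → length js % 2) (sym (powerSum≡0⇒[] m is sum≡0))) odd)

  partitions-finite : ∀ n b → b ≤ 1 → Finite (Partitions m n b)
  partitions-finite = <-rec FiniteForParities finite
    where
    FiniteForParities : ℕ → Set
    FiniteForParities n = ∀ b → b ≤ 1 → Finite (Partitions m n b)

    finite : ∀ n → (∀ {k} → k < n → FiniteForParities k) → FiniteForParities n
    finite zero    _   .0 z≤n       = 1 , even-partitions-of-0
    finite zero    _   .1 (s≤s z≤n) = Finite-empty no-odd-partition-of-0
    finite (suc n) rec b  b≤1       =
      Finite-↔ (↔-sym (partitions-suc-↔ b≤1))
               (Finite-⊎ (rec ≤-refl (1 ∸ b) (m∸n≤m 1 b)) withoutOnes-finite)
      where
      withoutOnes-finite : Finite (PartitionsWithoutOnes m (suc n) b)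
      withoutOnes-finite with m ∣? suc n
      ... | yes m∣n =
        Finite-↔ (↔-sym (withoutOnes-↔ (m∣n⇒n≡m*quotient m∣n))) (rec (quotient-< m∣n) b b≤1)
      ... | no  m∤n = Finite-empty (withoutOnes-indivisible m∤n)

  evenCount oddCount : ℕ → ℕ
  evenCount n = proj₁ (partitions-finite n 0 z≤n)
  oddCount  n = proj₁ (partitions-finite n 1 (s≤s z≤n))

  enumerate-even : ∀ n → Fin (evenCount n) ↔ EvenPartitions m n
  enumerate-even n = proj₂ (partitions-finite n 0 z≤n)

  enumerate-odd : ∀ n → Fin (oddCount n) ↔ OddPartitions m n
  enumerate-odd n = proj₂ (partitions-finite n 1 (s≤s z≤n))

  signedCount : ℕ → ℤ
  signedCount n = + evenCount n ℤ.- + oddCount n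

  signedCount-zero : signedCount 0 ≡ 1ℤ
  signedCount-zero = cong₂ (λ e o → + e ℤ.- + o)
    (card-unique (enumerate-even 0) even-partitions-of-0)
    (card-unique (enumerate-odd 0) (proj₂ (Finite-empty no-odd-partition-of-0)))

  signedCount-suc : Fin c ↔ PartitionsWithoutOnes m (suc n) 0 → Fin d ↔ PartitionsWithoutOnes m (suc n) 1 →
    signedCount (suc n) ≡ - signedCount n ℤ.+ (+ c ℤ.- + d)
  signedCount-suc {c} {n} {d} enum₀ enum₁ = begin
    + evenCount (suc n) ℤ.- + oddCount (suc n)
      ≡⟨ cong₂ (λ e o → + e ℤ.- + o)
           (card-⊎ (enumerate-odd n) enum₀ (↔-trans (enumerate-even (suc n)) (partitions-suc-↔ z≤n)))
           (card-⊎ (enumerate-even n) enum₁ (↔-trans (enumerate-odd (suc n)) (partitions-suc-↔ (s≤s z≤n)))) ⟩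
    + oddCount n ℤ.+ + c ℤ.- (+ evenCount n ℤ.+ + d)
      ≡⟨ regroup (+ oddCount n) (+ evenCount n) (+ c) (+ d) ⟩
    - signedCount n ℤ.+ (+ c ℤ.- + d) ∎
    where
    open ≡-Reasoning
    regroup : ∀ o e c d → (o ℤ.+ c) ℤ.- (e ℤ.+ d) ≡ - (e ℤ.- o) ℤ.+ (c ℤ.- d)
    regroup = solve-∀

  signedCount-indivisible : ¬ m ∣ suc n → signedCount (suc n) ≡ - signedCount n
  signedCount-indivisible m∤n = trans (signedCount-suc none none) (ℤP.+-identityʳ _)
    where
    none : Fin 0 ↔ PartitionsWithoutOnes m _ b
    none = proj₂ (Finite-empty (withoutOnes-indivisible m∤n))

  signedCount-divisible : ∀ k → suc n ≡ m * k → signedCount (suc n) ≡ - signedCount n ℤ.+ signedCount k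
  signedCount-divisible k eq = signedCount-suc
    (↔-trans (enumerate-even k) (↔-sym (withoutOnes-↔ eq)))
    (↔-trans (enumerate-odd k) (↔-sym (withoutOnes-↔ eq)))

sgn : ℕ → ℤ
sgn a = -1ℤ ℤ.^ a

sgn-suc : ∀ a → sgn (suc a) ≡ - sgn a
sgn-suc a = ℤP.-1*i≡-i (sgn a)

sgn-suc-suc : ∀ a → sgn (suc (suc a)) ≡ sgn a
sgn-suc-suc a = trans (sgn-suc (suc a)) (trans (cong -_ (sgn-suc a)) (ℤP.neg-involutive (sgn a)))

sgn-odd : ∀ a → a % 2 ≡ 1 → sgn a ≡ -1ℤ
sgn-odd (suc zero)    _   = refl
sgn-odd (suc (suc a)) odd = trans (sgn-suc-suc a) (sgn-odd a odd)

∣sgn∣≡1 : ∀ a → ∣ sgn a ∣ ≡ 1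
∣sgn∣≡1 zero    = refl
∣sgn∣≡1 (suc a) = trans (cong ∣_∣ (sgn-suc a)) (trans (ℤP.∣-i∣≡∣i∣ (sgn a)) (∣sgn∣≡1 a))

evenIndicator : ℕ → ℤ
evenIndicator zero          = 1ℤ
evenIndicator (suc zero)    = 0ℤ
evenIndicator (suc (suc a)) = evenIndicator a

evenIndicator-odd : ∀ a → a % 2 ≡ 1 → evenIndicator a ≡ 0ℤ
evenIndicator-odd (suc zero)    _   = refl
evenIndicator-odd (suc (suc a)) odd = evenIndicator-odd a odd

evenIndicator-suc : ∀ a → evenIndicator (suc a) ≡ evenIndicator a ℤ.+ sgn (suc a)
evenIndicator-suc zero          = refl
evenIndicator-suc (suc zero)    = refl
evenIndicator-suc (suc (suc a)) =
  trans (evenIndicator-suc a) (cong (λ s → evenIndicator a ℤ.+ s) (sym (sgn-suc-suc (suc a))))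

evenIndicatorProduct : List ℕ → ℤ
evenIndicatorProduct = foldr (λ a r → evenIndicator a ℤ.* r) 1ℤ

ZeroOrOne : ℤ → Set
ZeroOrOne x = x ≡ 0ℤ ⊎ x ≡ 1ℤ

evenIndicator-01 : ∀ a → ZeroOrOne (evenIndicator a)
evenIndicator-01 zero          = inj₂ refl
evenIndicator-01 (suc zero)    = inj₁ refl
evenIndicator-01 (suc (suc a)) = evenIndicator-01 a

evenIndicatorProduct-01 : ∀ as → ZeroOrOne (evenIndicatorProduct as)
evenIndicatorProduct-01 []       = inj₂ refl
evenIndicatorProduct-01 (a ∷ as) with evenIndicator a | evenIndicator-01 a
... | _ | inj₁ refl = inj₁ refl
... | _ | inj₂ refl = subst ZeroOrOne (sym (ℤP.*-identityˡ _)) (evenIndicatorProduct-01 as)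

/1-*-01 : ∀ x {y} → ZeroOrOne y → (x ℚ./ 1) ℚ.* (y ℚ./ 1) ≡ (x ℤ.* y) ℚ./ 1
/1-*-01 x (inj₁ refl) = trans (ℚP.*-zeroʳ (x ℚ./ 1)) (cong (ℚ._/ 1) (sym (ℤP.*-zeroʳ x)))
/1-*-01 x (inj₂ refl) = trans (ℚP.*-identityʳ (x ℚ./ 1)) (cong (ℚ._/ 1) (sym (ℤP.*-identityʳ x)))

∣unit*01∣≤1 : ∀ x {y} → ∣ x ∣ ≡ 1 → ZeroOrOne y → ∣ x ℤ.* y ∣ ≤ 1
∣unit*01∣≤1 x _     (inj₁ refl) = subst (_≤ 1) (sym (cong ∣_∣ (ℤP.*-zeroʳ x))) z≤n
∣unit*01∣≤1 x ∣x∣≡1 (inj₂ refl) = ≤-reflexive (trans (cong ∣_∣ (ℤP.*-identityʳ x)) ∣x∣≡1)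

halfFactor≡evenIndicator : ∀ a → halfFactor a ≡ evenIndicator a ℚ./ 1
halfFactor≡evenIndicator zero          = refl
halfFactor≡evenIndicator (suc zero)    = refl
halfFactor≡evenIndicator (suc (suc a)) =
  trans (cong (λ s → (1ℤ ℤ.+ s) ℚ./ 2) (sgn-suc-suc a)) (halfFactor≡evenIndicator a)

prodHalfFactors≡evenIndicatorProduct : ∀ as → prodHalfFactors as ≡ evenIndicatorProduct as ℚ./ 1
prodHalfFactors≡evenIndicatorProduct []       = refl
prodHalfFactors≡evenIndicatorProduct (a ∷ as) =
  trans (cong₂ ℚ._*_ (halfFactor≡evenIndicator a) (prodHalfFactors≡evenIndicatorProduct as))
        (/1-*-01 (evenIndicator a) (evenIndicatorProduct-01 as))

digit+multiple-indivisible : ∀ {m a} k → suc a < m → ¬ m ∣ suc a + m * k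
digit+multiple-indivisible {m} {a} k a<m m∣ =
  <⇒≱ a<m (∣⇒≤ (∣m+n∣m⇒∣n (subst (m ∣_) (+-comm (suc a) (m * k)) m∣) (m∣m*n k)))

module DigitFormula (m′ : ℕ) (m′-odd : m′ % 2 ≡ 1) (f : ℕ → ℤ)
  (f-zero : f 0 ≡ 1ℤ)
  (f-indivisible : ∀ {n} → ¬ suc m′ ∣ suc n → f (suc n) ≡ - f n)
  (f-divisible : ∀ {n} k → suc n ≡ suc m′ * k → f (suc n) ≡ - f n ℤ.+ f k) where

  open ≡-Reasoning

  m : ℕ
  m = suc m′

  partialSum : ℕ → ℤ
  partialSum zero    = f 0
  partialSum (suc k) = partialSum k ℤ.+ f (suc k)

  mutual
    f-multiple : ∀ k → f (m * k) ≡ partialSum k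
    f-multiple zero    = cong f (*-zeroʳ m)
    f-multiple (suc k) = begin
      f (m * suc k)
        ≡⟨ cong f (*-suc m k) ⟩
      f (suc (m′ + m * k))
        ≡⟨ f-divisible (suc k) (sym (*-suc m k)) ⟩
      - f (m′ + m * k) ℤ.+ f (suc k)
        ≡⟨ cong (λ x → - x ℤ.+ f (suc k)) (f-digit k m′ ≤-refl) ⟩
      - (sgn m′ ℤ.* partialSum k) ℤ.+ f (suc k)
        ≡⟨ cong (λ s → - (s ℤ.* partialSum k) ℤ.+ f (suc k)) (sgn-odd m′ m′-odd) ⟩
      - (-1ℤ ℤ.* partialSum k) ℤ.+ f (suc k)
        ≡⟨ cong (λ x → - x ℤ.+ f (suc k)) (ℤP.-1*i≡-i (partialSum k)) ⟩
      - - partialSum k ℤ.+ f (suc k)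
        ≡⟨ cong (ℤ._+ f (suc k)) (ℤP.neg-involutive (partialSum k)) ⟩
      partialSum (suc k)
        ∎

    f-digit : ∀ k a → a < m → f (a + m * k) ≡ sgn a ℤ.* partialSum k
    f-digit k zero    _          = trans (f-multiple k) (sym (ℤP.*-identityˡ _))
    f-digit k (suc a) (s≤s a<m′) = begin
      f (suc a + m * k)                ≡⟨ f-indivisible (digit+multiple-indivisible k (s≤s a<m′)) ⟩
      - f (a + m * k)                  ≡⟨ cong -_ (f-digit k a (m≤n⇒m≤1+n a<m′)) ⟩
      - (sgn a ℤ.* partialSum k)       ≡⟨ ℤP.neg-distribˡ-* (sgn a) (partialSum k) ⟩
      - sgn a ℤ.* partialSum k         ≡⟨ cong (ℤ._* partialSum k) (sym (sgn-suc a)) ⟩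
      sgn (suc a) ℤ.* partialSum k     ∎

  mutual
    partialSum-multiple : ∀ k → partialSum (m * k) ≡ partialSum k
    partialSum-multiple zero    = cong partialSum (*-zeroʳ m)
    partialSum-multiple (suc k) = begin
      partialSum (m * suc k)
        ≡⟨ cong partialSum (*-suc m k) ⟩
      partialSum (m′ + m * k) ℤ.+ f (suc (m′ + m * k))
        ≡⟨ cong₂ ℤ._+_ (partialSum-digit k m′ ≤-refl) (cong f (sym (*-suc m k))) ⟩
      evenIndicator m′ ℤ.* partialSum k ℤ.+ f (m * suc k)
        ≡⟨ cong₂ (λ e x → e ℤ.* partialSum k ℤ.+ x) (evenIndicator-odd m′ m′-odd) (f-multiple (suc k)) ⟩
      0ℤ ℤ.+ partialSum (suc k)
        ≡⟨ ℤP.+-identityˡ _ ⟩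
      partialSum (suc k)
        ∎

    partialSum-digit : ∀ k a → a < m → partialSum (a + m * k) ≡ evenIndicator a ℤ.* partialSum k
    partialSum-digit k zero    _          = trans (partialSum-multiple k) (sym (ℤP.*-identityˡ _))
    partialSum-digit k (suc a) (s≤s a<m′) = begin
      partialSum (a + m * k) ℤ.+ f (suc a + m * k)
        ≡⟨ cong₂ ℤ._+_ (partialSum-digit k a (m≤n⇒m≤1+n a<m′)) (f-digit k (suc a) (s≤s a<m′)) ⟩
      evenIndicator a ℤ.* partialSum k ℤ.+ sgn (suc a) ℤ.* partialSum k
        ≡⟨ ℤP.*-distribʳ-+ (partialSum k) (evenIndicator a) (sgn (suc a)) ⟨
      (evenIndicator a ℤ.+ sgn (suc a)) ℤ.* partialSum k
        ≡⟨ cong (ℤ._* partialSum k) (evenIndicator-suc a) ⟨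
      evenIndicator (suc a) ℤ.* partialSum k
        ∎

  partialSum-digits : ∀ ds → All (_< m) ds → partialSum (baseValue m ds) ≡ evenIndicatorProduct ds
  partialSum-digits []       []          = f-zero
  partialSum-digits (d ∷ ds) (d<m ∷ ds<m) =
    trans (partialSum-digit _ d d<m) (cong (evenIndicator d ℤ.*_) (partialSum-digits ds ds<m))

  f-digits : ∀ a₀ as → All (_< m) (a₀ ∷ as) →
    f (baseValue m (a₀ ∷ as)) ≡ sgn a₀ ℤ.* evenIndicatorProduct as
  f-digits a₀ as (a₀<m ∷ as<m) =
    trans (f-digit _ a₀ a₀<m) (cong (sgn a₀ ℤ.*_) (partialSum-digits as as<m))

corollary3p4 : (m : ℕ) → 2 ≤ m → (Σ ℕ λ t → m ≡ 2 ℕ.* t) →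
    (n : ℕ) → (a₀ : ℕ) → (as : List ℕ) →
    All (_< m) (a₀ ∷ as) → (as ≡ [] ⊎ Σ ℕ λ d → last as ≡ just d × d ≢ 0) →
    baseValue m (a₀ ∷ as) ≡ n →
    Σ ℕ λ e → Σ ℕ λ o →
      (Fin e ↔ EvenPartitions m n) × (Fin o ↔ OddPartitions m n) ×
      (((+ e ℤ.- + o) ℚ./ 1) ≡ ((-1ℤ ℤ.^ a₀) ℚ./ 1) ℚ.* prodHalfFactors as) ×
      (ℤ.∣ + e ℤ.- + o ∣ ℕ.≤ 1)
corollary3p4 m@(suc m′@(suc _)) (s≤s (s≤s z≤n)) (t , m≡2t) n a₀ as digits _ value =
  evenCount n , oddCount n , enumerate-even n , enumerate-odd n , rational-formula , bound
  where
  open Counting m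
  open DigitFormula m′ ([1+m]≡2*t⇒m%2≡1 t m≡2t) signedCount signedCount-zero
    signedCount-indivisible signedCount-divisible

  signedCount-formula : signedCount n ≡ sgn a₀ ℤ.* evenIndicatorProduct as
  signedCount-formula = trans (cong signedCount (sym value)) (f-digits a₀ as digits)

  rational-formula : signedCount n ℚ./ 1 ≡ (sgn a₀ ℚ./ 1) ℚ.* prodHalfFactors as
  rational-formula = begin
    signedCount n ℚ./ 1
      ≡⟨ cong (ℚ._/ 1) signedCount-formula ⟩
    (sgn a₀ ℤ.* evenIndicatorProduct as) ℚ./ 1
      ≡⟨ /1-*-01 (sgn a₀) (evenIndicatorProduct-01 as) ⟨
    (sgn a₀ ℚ./ 1) ℚ.* (evenIndicatorProduct as ℚ./ 1)
      ≡⟨ cong ((sgn a₀ ℚ./ 1) ℚ.*_) (prodHalfFactors≡evenIndicatorProduct as) ⟨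
    (sgn a₀ ℚ./ 1) ℚ.* prodHalfFactors as
      ∎
    where open ≡-Reasoning

  bound : ∣ signedCount n ∣ ≤ 1
  bound = subst (λ x → ∣ x ∣ ≤ 1) (sym signedCount-formula)
    (∣unit*01∣≤1 (sgn a₀) (∣sgn∣≡1 a₀) (evenIndicatorProduct-01 as))
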